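{- Let $T$ be a finite rooted tree with root $v$, $n$ vertices and $l$ leaves, where the root is not counted as a leaf. Then $\alpha(T,v)\ge n-l-1+2^l$.
   Context: A leaf here is a non-root vertex of degree $1$ (the root is never counted as a leaf, even if it has degree $1$). A subtree of $T$ is a nonempty subset of $V(T)$ inducing a connected subgraph; $\alpha(T,v)$ denotes the number of subtrees of $T$ containing $v$. -}

module Defs where

open import Data.Nat using (ℕ; zero; suc; _≤_; _+_; _≡ᵇ_)
open import Data.Fin using (Fin; zero; suc; toℕ; _≟_)
open import Data.Fin.Subset using (Subset; _∈_)
open import Data.Bool using (Bool; true; false; _∨_; _∧_; not; if_then_else_; T)
open import Data.List using (List; map; allFin)
open import Data.Nat.ListAction using (sum)
open import Data.Product using (_×_)
open import Relation.Nullary using (does)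
open import Relation.Binary.Construct.Closure.ReflexiveTransitive using (Star)

-- A finite rooted tree, encoded by a parent function.
-- Vertex set: Fin (suc m)  (so n = suc m ≥ 1 vertices); the root is vertex zero.
-- Vertex (suc i) has parent (parent i), whose index is ≤ i (i.e. strictly smaller
-- than that of suc i).  Every finite rooted tree has such a labelling (e.g. BFS order),
-- and every such parent function yields a tree.
record RootedTree : Set where
  field
    m       : ℕ
    parent  : Fin m → Fin (suc m)
    parent< : ∀ i → toℕ (parent i) ≤ toℕ i

module _ (t : RootedTree) where
  open RootedTree t

  size : ℕ
  size = suc m

  Vertex : Set
  Vertex = Fin (suc m)

  root : Vertex
  root = zero

  isChildOf : Vertex → Vertex → Bool
  isChildOf zero    w = false
  isChildOf (suc i) w = does (parent i ≟ w)

  adj : Vertex → Vertex → Bool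
  adj u w = isChildOf u w ∨ isChildOf w u

  Adj : Vertex → Vertex → Set
  Adj u w = T (adj u w)

  degree : Vertex → ℕ
  degree u = sum (map (λ w → if adj u w then 1 else 0) (allFin (suc m)))

  isRoot : Vertex → Bool
  isRoot zero    = true
  isRoot (suc _) = false

  isLeaf : Vertex → Bool
  isLeaf u = not (isRoot u) ∧ (degree u ≡ᵇ 1)

  leaves : ℕ
  leaves = sum (map (λ u → if isLeaf u then 1 else 0) (allFin (suc m)))

  InducedConnected : Subset (suc m) → Set
  InducedConnected S =
    ∀ u w → u ∈ S → w ∈ S → Star (λ a b → a ∈ S × b ∈ S × Adj a b) u w

  -- S is a subtree of T containing the vertex v
  -- (nonemptiness is implied by v ∈ S)
  SubtreeContaining : Vertex → Subset (suc m) → Set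
  SubtreeContaining v S = v ∈ S × InducedConnected S

-- For every non-root vertex u that is not a leaf, the path from u to the root is a
-- subtree containing the root; for every set B of leaves, the union of the root and
-- the paths from the leaves in B is another one.  A leaf lies on the path of no
-- vertex but itself, so the second kind of subtree determines B through its leaves,
-- and it differs from every path of the first kind: such a path contains no leaf,
-- so it could only be the subtree for B = ∅, which is the root alone.
module Submission where

open import Defs
open import Data.Nat using (ℕ; zero; suc; _∸_; _+_; _^_; _≤_; s≤s; z≤n)
open import Data.Nat.Properties
  using (≤-trans; ≤-refl; n≤1+n; m≤n+m; n≮n; <-asym; +-suc; +-comm; ∸-+-assoc; m+n∸n≡m; ≡ᵇ⇒≡)
open import Data.Fin
  using (Fin; zero; suc; toℕ; _<_; _≟_; cast; splitAt; join; combine; finToFun; funToFin)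
open import Data.Fin.Patterns using (0F; 1F)
open import Data.Fin.Properties
  using (toℕ-cast; toℕ-injective; suc-injective; 0≢1+n; join-splitAt; funToFin-finToFin; any?)
open import Data.Fin.Induction using (<-wellFounded)
open import Data.Fin.Subset using (Subset; _∈_)
open import Data.Bool using (Bool; true; false; not; T; if_then_else_)
open import Data.Bool.Properties using (∨-comm)
open import Data.Unit using (tt)
open import Data.Empty using (⊥-elim)
open import Data.Sum using (_⊎_; inj₁; inj₂)
open import Data.Product using (Σ; ∃; _×_; _,_; proj₁; proj₂)
open import Data.List using (List; []; _∷_; map; length; lookup; filter; tabulate; allFin)
open import Data.List.Properties using (length-tabulate)
open import Data.List.Membership.Propositional using () renaming (_∈_ to _∈ₗ_)
open import Data.List.Membership.Propositional.Properties
  using (∈-lookup; ∈-filter⁻; ∈-allFin; ∈-tabulate⁻)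
open import Data.List.Relation.Unary.Any using (here; there)
open import Data.List.Relation.Unary.All as All using ()
open import Data.List.Relation.Unary.AllPairs using (_∷_)
open import Data.List.Relation.Unary.Unique.Propositional using (Unique)
open import Data.List.Relation.Unary.Unique.Propositional.Properties
  using (filter⁺; tabulate⁺; allFin⁺)
open import Data.Nat.ListAction using (sum)
open import Data.Vec as Vec using ()
open import Data.Vec.Properties using (lookup∘tabulate; []=⇒lookup; lookup⇒[]=)
open import Function using (_∘_)
open import Function.Definitions using (Injective)
open import Induction.WellFounded using (WfRec; module All)
open import Level using (Level; 0ℓ)
open import Relation.Nullary using (Dec; yes; no; ¬_; does; contradiction)
open import Relation.Nullary.Decidable using (map′; dec-true; _×-dec_; _⊎-dec_)
open import Relation.Nullary.Decidable.Core using (T?; ¬?)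
open import Relation.Unary using (Pred; Decidable; _⊆_)
open import Relation.Binary.PropositionalEquality
  using (_≡_; _≢_; refl; sym; trans; cong; cong₂; subst; module ≡-Reasoning)
open import Relation.Binary.Construct.Closure.ReflexiveTransitive
  using (Star; ε; _◅_; _◅◅_; reverse)

private
  variable
    ℓ : Level
    A : Set
    n : ℕ

-- Shaped like leaves and degree in Defs, which are therefore counts over allFin.
count : (A → Bool) → List A → ℕ
count p xs = sum (map (λ x → if p x then 1 else 0) xs)

count≡length-filter : ∀ {P : Pred A ℓ} (P? : Decidable P) xs →
                      count (does ∘ P?) xs ≡ length (filter P? xs)
count≡length-filter P? []       = refl
count≡length-filter P? (x ∷ xs) with P? x
... | yes _ = cong suc (count≡length-filter P? xs)
... | no _  = count≡length-filter P? xs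

count-not+count : ∀ (p : A → Bool) xs → count (not ∘ p) xs + count p xs ≡ length xs
count-not+count p []       = refl
count-not+count p (x ∷ xs) with p x
... | true  = trans (+-suc _ _) (cong suc (count-not+count p xs))
... | false = cong suc (count-not+count p xs)

count-not : ∀ (p : A → Bool) xs → count (not ∘ p) xs ≡ length xs ∸ count p xs
count-not p xs =
  trans (sym (m+n∸n≡m _ (count p xs))) (cong (_∸ count p xs) (count-not+count p xs))

1≤count : ∀ (p : A → Bool) {x xs} → x ∈ₗ xs → T (p x) → 1 ≤ count p xs
1≤count p {x} (here refl) px with p x
... | true = s≤s z≤n
1≤count p (there x∈xs) px = ≤-trans (1≤count p x∈xs px) (m≤n+m _ _)

2≤count : ∀ (p : A → Bool) {x y xs} →
          x ∈ₗ xs → y ∈ₗ xs → x ≢ y → T (p x) → T (p y) → 2 ≤ count p xs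
2≤count p (here refl) (here refl) x≢y _ _ = contradiction refl x≢y
2≤count p {x} (here refl) (there y∈xs) _ px py with p x
... | true = s≤s (1≤count p y∈xs py)
2≤count p {y = y} (there x∈xs) (here refl) _ px py with p y
... | true = s≤s (1≤count p x∈xs px)
2≤count p (there x∈xs) (there y∈xs) x≢y px py =
  ≤-trans (2≤count p x∈xs y∈xs x≢y px py) (m≤n+m _ _)

Unique⇒lookup-injective : ∀ {xs : List A} → Unique xs → Injective _≡_ _≡_ (lookup xs)
Unique⇒lookup-injective (_ ∷ _)    {zero}  {zero}  _  = refl
Unique⇒lookup-injective (x∉ ∷ _)   {zero}  {suc j} eq =
  contradiction eq (All.lookup x∉ (∈-lookup j))
Unique⇒lookup-injective (x∉ ∷ _)   {suc i} {zero}  eq =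
  contradiction (sym eq) (All.lookup x∉ (∈-lookup i))
Unique⇒lookup-injective (_ ∷ uniq) {suc i} {suc j} eq =
  cong suc (Unique⇒lookup-injective uniq eq)

cast-injective : ∀ {m} .(eq : m ≡ n) → Injective _≡_ _≡_ (cast eq)
cast-injective eq {i} {j} e =
  toℕ-injective (trans (sym (toℕ-cast eq i)) (trans (cong toℕ e) (toℕ-cast eq j)))

splitAt-injective : ∀ m → Injective _≡_ _≡_ (splitAt m {n})
splitAt-injective {n} m {i} {j} e =
  trans (sym (join-splitAt m n i)) (trans (cong (join m n) e) (join-splitAt m n j))

funToFin-cong : ∀ {m} {f g : Fin n → Fin m} → (∀ i → f i ≡ g i) → funToFin f ≡ funToFin g
funToFin-cong {zero}  _   = refl
funToFin-cong {suc n} f≗g = cong₂ combine (f≗g zero) (funToFin-cong (f≗g ∘ suc))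

finToFun-injective : ∀ {m} {f g : Fin (m ^ n)} →
                     (∀ i → finToFun {m} {n} f i ≡ finToFun g i) → f ≡ g
finToFun-injective {n} {m} {f} {g} f≗g =
  trans (sym (funToFin-finToFin {n} {m} f))
        (trans (funToFin-cong f≗g) (funToFin-finToFin {n} {m} g))

bit-ext : {x y : Fin 2} → (x ≡ 1F → y ≡ 1F) → (y ≡ 1F → x ≡ 1F) → x ≡ y
bit-ext {0F} {0F} _   _   = refl
bit-ext {0F} {1F} _   y⇒x = contradiction (y⇒x refl) 0≢1+n
bit-ext {1F} {0F} x⇒y _   = contradiction (x⇒y refl) 0≢1+n
bit-ext {1F} {1F} _   _   = refl

subsetOf : {P : Pred (Fin n) ℓ} → Decidable P → Subset n
subsetOf P? = Vec.tabulate (does ∘ P?)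

module _ {P : Pred (Fin n) ℓ} (P? : Decidable P) where

  ∈subsetOf⁺ : ∀ {x} → P x → x ∈ subsetOf P?
  ∈subsetOf⁺ {x} px = lookup⇒[]= x _ (trans (lookup∘tabulate _ x) (dec-true (P? x) px))

  ∈subsetOf⁻ : ∀ {x} → x ∈ subsetOf P? → P x
  ∈subsetOf⁻ {x} x∈ with P? x | trans (sym (lookup∘tabulate (does ∘ P?) x)) ([]=⇒lookup x∈)
  ... | yes px | _  = px
  ... | no _   | ()

subsetOf-≡⇒⊆ : {P Q : Pred (Fin n) ℓ} (P? : Decidable P) (Q? : Decidable Q) →
               subsetOf P? ≡ subsetOf Q? → P ⊆ Q
subsetOf-≡⇒⊆ P? Q? eq px = ∈subsetOf⁻ Q? (subst (_ ∈_) eq (∈subsetOf⁺ P? px))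

module _ (t : RootedTree) where
  open RootedTree t

  infix 4 _⟶_ _↝_ _↝?_

  data _⟶_ : Vertex t → Vertex t → Set where
    up : ∀ i → suc i ⟶ parent i

  _↝_ : Vertex t → Vertex t → Set
  _↝_ = Star _⟶_

  parent<suc : ∀ i → parent i < suc i
  parent<suc i = s≤s (parent< i)

  ↝-root : ∀ u → u ↝ root t
  ↝-root = All.wfRec <-wellFounded _ (_↝ root t) step
    where
      step : ∀ u → WfRec _<_ (_↝ root t) u → u ↝ root t
      step zero    _   = ε
      step (suc i) rec = up i ◅ rec (parent<suc i)

  root-↝ : ∀ {w} → root t ↝ w → root t ≡ w
  root-↝ ε = refl

  suc-↝ : ∀ {i w} → suc i ↝ w → suc i ≢ w → parent i ↝ w
  suc-↝ ε          sᵢ≢w = contradiction refl sᵢ≢w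
  suc-↝ (up _ ◅ r) _    = r

  _↝?_ : ∀ u w → Dec (u ↝ w)
  u ↝? w = All.wfRec <-wellFounded _ (λ u → Dec (u ↝ w)) step u
    where
      step : ∀ u → WfRec _<_ (λ u → Dec (u ↝ w)) u → Dec (u ↝ w)
      step u rec with u ≟ w
      ... | yes refl = yes ε
      step zero    rec | no u≢w = no (u≢w ∘ root-↝)
      step (suc i) rec | no u≢w =
        map′ (up i ◅_) (λ r → suc-↝ r u≢w) (rec (parent<suc i))

  ↝-≤ : ∀ {u w} → u ↝ w → toℕ w ≤ toℕ u
  ↝-≤ ε          = ≤-refl
  ↝-≤ (up i ◅ r) = ≤-trans (↝-≤ r) (≤-trans (parent< i) (n≤1+n _))

  ↝-antisym : ∀ {u w} → u ↝ w → w ↝ u → u ≡ w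
  ↝-antisym ε          _   = refl
  ↝-antisym (up i ◅ r) w↝u =
    contradiction (≤-trans (↝-≤ w↝u) (≤-trans (↝-≤ r) (parent< i))) (n≮n _)

  ↝-ends-at-parent : ∀ {u w} → u ↝ w → u ≡ w ⊎ ∃ λ j → parent j ≡ w
  ↝-ends-at-parent ε = inj₁ refl
  ↝-ends-at-parent (up i ◅ r) with ↝-ends-at-parent r
  ... | inj₁ refl      = inj₂ (i , refl)
  ... | inj₂ has-child = inj₂ has-child

  adj-parent : ∀ i → Adj t (suc i) (parent i)
  adj-parent i with parent i ≟ parent i
  ... | yes _  = tt
  ... | no p≢p = contradiction refl p≢p

  adj-sym : ∀ {u w} → Adj t u w → Adj t w u
  adj-sym {u} {w} = subst T (∨-comm (isChildOf t u w) (isChildOf t w u))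

  child⇒¬leaf : ∀ {u} j → parent j ≡ u → ¬ T (isLeaf t u)
  child⇒¬leaf {zero}  j _     ()
  child⇒¬leaf {suc i} j pⱼ≡sᵢ leaf = n≮n 1 (subst (2 ≤_) (≡ᵇ⇒≡ _ 1 leaf) two-neighbours)
    where
      parent≢child : parent i ≢ suc j
      parent≢child pᵢ≡sⱼ = <-asym (subst (λ v → toℕ v ≤ toℕ j) pⱼ≡sᵢ (parent< j))
                                  (subst (λ v → toℕ v ≤ toℕ i) pᵢ≡sⱼ (parent< i))

      two-neighbours : 2 ≤ degree t (suc i)
      two-neighbours = 2≤count (adj t (suc i)) (∈-allFin _) (∈-allFin _) parent≢child
        (adj-parent i) (subst (λ v → Adj t v (suc j)) pⱼ≡sᵢ (adj-sym {suc j} (adj-parent j)))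

  ↝-leaf : ∀ {u ℓ} → T (isLeaf t ℓ) → u ↝ ℓ → u ≡ ℓ
  ↝-leaf leaf r with ↝-ends-at-parent r
  ... | inj₁ u≡ℓ        = u≡ℓ
  ... | inj₂ (j , pⱼ≡ℓ) = contradiction leaf (child⇒¬leaf j pⱼ≡ℓ)

  ParentClosed : Pred (Vertex t) ℓ → Set ℓ
  ParentClosed P = ∀ i → P (suc i) → P (parent i)

  parentClosed⇒subtree : {P : Pred (Vertex t) ℓ} (P? : Decidable P) →
                         P (root t) → ParentClosed P →
                         SubtreeContaining t (root t) (subsetOf P?)
  parentClosed⇒subtree {P = P} P? P-root closed =
    ∈subsetOf⁺ P? P-root , λ u w u∈S w∈S →
      path-to-root u u∈S ◅◅ reverse flip-edge (path-to-root w w∈S)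
    where
      S = subsetOf P?

      Edge : Vertex t → Vertex t → Set
      Edge a b = a ∈ S × b ∈ S × Adj t a b

      flip-edge : ∀ {a b} → Edge a b → Edge b a
      flip-edge {a} {b} (a∈S , b∈S , a~b) = b∈S , a∈S , adj-sym {a} {b} a~b

      path : ∀ {u w} → u ↝ w → P u → Star Edge u w
      path ε          _  = ε
      path (up i ◅ r) Pu =
        (∈subsetOf⁺ P? Pu , ∈subsetOf⁺ P? (closed i Pu) , adj-parent i) ◅ path r (closed i Pu)

      path-to-root : ∀ u → u ∈ S → Star Edge u (root t)
      path-to-root u u∈S = path (↝-root u) (∈subsetOf⁻ P? u∈S)

  nonRoot : List (Vertex t)
  nonRoot = tabulate {n = m} suc

  leafList : List (Vertex t)
  leafList = filter (T? ∘ isLeaf t) (allFin (size t))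

  innerList : List (Vertex t)
  innerList = filter (¬? ∘ T? ∘ isLeaf t) nonRoot

  length-leafList : length leafList ≡ leaves t
  length-leafList = sym (count≡length-filter (T? ∘ isLeaf t) (allFin (size t)))

  -- allFin (size t) unfolds to zero ∷ nonRoot and the root is no leaf, so
  -- leaves t is count (isLeaf t) nonRoot.
  length-innerList : length innerList ≡ size t ∸ leaves t ∸ 1
  length-innerList = begin
    length innerList                ≡⟨ count≡length-filter (¬? ∘ T? ∘ isLeaf t) nonRoot ⟨
    count (not ∘ isLeaf t) nonRoot  ≡⟨ count-not (isLeaf t) nonRoot ⟩
    length nonRoot ∸ leaves t       ≡⟨ cong (_∸ leaves t) (length-tabulate {n = m} suc) ⟩
    m ∸ leaves t                    ≡⟨ cong (suc m ∸_) (+-comm 1 (leaves t)) ⟩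
    suc m ∸ (leaves t + 1)          ≡⟨ ∸-+-assoc (suc m) (leaves t) 1 ⟨
    size t ∸ leaves t ∸ 1           ∎
    where open ≡-Reasoning

  leaf : Fin (length leafList) → Vertex t
  leaf = lookup leafList

  inner : Fin (length innerList) → Vertex t
  inner = lookup innerList

  leaf-isLeaf : ∀ k → T (isLeaf t (leaf k))
  leaf-isLeaf k = proj₂ (∈-filter⁻ (T? ∘ isLeaf t) {xs = allFin (size t)} (∈-lookup k))

  leaf-injective : Injective _≡_ _≡_ leaf
  leaf-injective = Unique⇒lookup-injective (filter⁺ (T? ∘ isLeaf t) (allFin⁺ (size t)))

  inner∈innerList : ∀ k → inner k ∈ₗ nonRoot × ¬ T (isLeaf t (inner k))
  inner∈innerList k = ∈-filter⁻ (¬? ∘ T? ∘ isLeaf t) {xs = nonRoot} (∈-lookup k)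

  inner-≢root : ∀ k → inner k ≢ root t
  inner-≢root k inner≡root with ∈-tabulate⁻ (proj₁ (inner∈innerList k))
  ... | _ , inner≡suc = 0≢1+n (trans (sym inner≡root) inner≡suc)

  inner-injective : Injective _≡_ _≡_ inner
  inner-injective =
    Unique⇒lookup-injective (filter⁺ (¬? ∘ T? ∘ isLeaf t) (tabulate⁺ {n = m} suc-injective))

  LeafUnion : (Fin (length leafList) → Fin 2) → Pred (Vertex t) 0ℓ
  LeafUnion b w = w ≡ root t ⊎ ∃ λ k → b k ≡ 1F × leaf k ↝ w

  leafUnion? : ∀ b → Decidable (LeafUnion b)
  leafUnion? b w = (w ≟ root t) ⊎-dec any? (λ k → (b k ≟ 1F) ×-dec (leaf k ↝? w))

  leaf∈LeafUnion : ∀ b k → b k ≡ 1F → LeafUnion b (leaf k)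
  leaf∈LeafUnion b k bₖ≡1 = inj₂ (k , bₖ≡1 , ε)

  LeafUnion-leaf : ∀ b k → LeafUnion b (leaf k) → b k ≡ 1F
  LeafUnion-leaf b k (inj₁ leaf≡root)      =
    ⊥-elim (subst (T ∘ isLeaf t) leaf≡root (leaf-isLeaf k))
  LeafUnion-leaf b k (inj₂ (j , bⱼ≡1 , r)) =
    subst (λ j → b j ≡ 1F) (leaf-injective (↝-leaf (leaf-isLeaf k) r)) bⱼ≡1

  -- If inner k were in LeafUnion b through a selected leaf, that leaf would lie on the
  -- path of inner k and hence be inner k itself.
  inner-path≢LeafUnion : ∀ k b → (inner k ↝_) ⊆ LeafUnion b → ¬ LeafUnion b ⊆ (inner k ↝_)
  inner-path≢LeafUnion k b ⊆′ ⊇′ with ⊆′ ε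
  ... | inj₁ inner≡root     = inner-≢root k inner≡root
  ... | inj₂ (j , bⱼ≡1 , _) =
    proj₂ (inner∈innerList k) (subst (T ∘ isLeaf t) (sym inner≡leaf) (leaf-isLeaf j))
    where inner≡leaf = ↝-leaf (leaf-isLeaf j) (⊇′ (leaf∈LeafUnion b j bⱼ≡1))

  Index : Set
  Index = Fin (length innerList) ⊎ Fin (2 ^ length leafList)

  Member : Index → Pred (Vertex t) 0ℓ
  Member (inj₁ k) = inner k ↝_
  Member (inj₂ c) = LeafUnion (finToFun c)

  member? : ∀ s → Decidable (Member s)
  member? (inj₁ k) = inner k ↝?_
  member? (inj₂ c) = leafUnion? (finToFun c)

  Member-injective : ∀ s s′ → Member s ⊆ Member s′ → Member s′ ⊆ Member s → s ≡ s′
  Member-injective (inj₁ k) (inj₁ k′) ⊆′ ⊇′ =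
    cong inj₁ (inner-injective (↝-antisym (⊇′ ε) (⊆′ ε)))
  Member-injective (inj₁ k) (inj₂ c)  ⊆′ ⊇′ = ⊥-elim (inner-path≢LeafUnion k _ ⊆′ ⊇′)
  Member-injective (inj₂ c) (inj₁ k)  ⊆′ ⊇′ = ⊥-elim (inner-path≢LeafUnion k _ ⊇′ ⊆′)
  Member-injective (inj₂ c) (inj₂ c′) ⊆′ ⊇′ = cong inj₂ (finToFun-injective λ k →
    bit-ext (LeafUnion-leaf _ k ∘ ⊆′ ∘ leaf∈LeafUnion _ k)
            (LeafUnion-leaf _ k ∘ ⊇′ ∘ leaf∈LeafUnion _ k))

  subtree : Index → Subset (size t)
  subtree s = subsetOf (member? s)

  subtree-injective : Injective _≡_ _≡_ subtree
  subtree-injective {s} {s′} eq = Member-injective s s′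
    (subsetOf-≡⇒⊆ (member? s) (member? s′) eq) (subsetOf-≡⇒⊆ (member? s′) (member? s) (sym eq))

  subtree-containsRoot : ∀ s → SubtreeContaining t (root t) (subtree s)
  subtree-containsRoot (inj₁ k) =
    parentClosed⇒subtree (member? (inj₁ k)) (↝-root (inner k)) (λ i r → r ◅◅ up i ◅ ε)
  subtree-containsRoot (inj₂ c) =
    parentClosed⇒subtree (member? (inj₂ c)) (inj₁ refl) closed
    where
      closed : ParentClosed (LeafUnion (finToFun c))
      closed i (inj₁ ())
      closed i (inj₂ (k , bₖ≡1 , r)) = inj₂ (k , bₖ≡1 , r ◅◅ up i ◅ ε)

lemma8 : (t : RootedTree) →
    Σ (Fin ((size t ∸ leaves t ∸ 1) + 2 ^ leaves t) → Subset (size t)) λ f →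
    Injective _≡_ _≡_ f × (∀ k → SubtreeContaining t (root t) (f k))
lemma8 t =
  subtree t ∘ splitAt _ ∘ cast index-count ,
  cast-injective index-count ∘ splitAt-injective _ ∘ subtree-injective t ,
  λ k → subtree-containsRoot t (splitAt _ (cast index-count k))
  where
    index-count : (size t ∸ leaves t ∸ 1) + 2 ^ leaves t
                ≡ length (innerList t) + 2 ^ length (leafList t)
    index-count = cong₂ (λ a l → a + 2 ^ l) (sym (length-innerList t)) (sym (length-leafList t))
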